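{- Let $A$ be a setoid, $B$ a setoid family over $A$ and $(C,a_C)$ a $P_B$-algebra. Let $w,w':W$, $\gamma:w\approx_Ww'$ with inverse (symmetry proof) $\gamma^{ -1}:w'\approx_Ww$, and $k:\mathsf{ImS}\,w\Rightarrow C$. Then \[\mathsf{RecDef}\,w\,k\to\mathsf{RecDef}\,w'\,(k\circ\mathsf{ImS}_{\gamma^{ -1}}).\]
   Context: Setting: intensional Martin-Löf type theory with $\Pi$-types and a universe $\mathsf{U}$ closed under $\Pi$ and containing intensional $\Sigma$-types, identity types, the unit type, W-types and dependent W-types (inductive families); logic is propositions-as-types. A setoid $X$ is a tuple $(X_0,\approx_X,r_X,s_X,t_X)$ with $X_0:\mathsf{U}$, $\approx_X:X_0\to X_0\to\mathsf{U}$ and witnesses of reflexivity, symmetry, transitivity; $x:X$ means $x:X_0$. An extensional function $f:X\Rightarrow Y$ is $f_0:X_0\to Y_0$ with a proof of $\prod_{x,x'}x\approx x'\to f_0x\approx f_0x'$; the setoid $X\Rightarrow Y$ has $f\approx g:=\prod_x f_0x\approx g_0x$. A setoid family $B$ over a setoid $A$ gives a setoid $B\,a$ (underlying type $B_0a$) for $a:A$ and extensional transports $B_\alpha:B\,a\Rightarrow B\,a'$ for $\alpha:a\approx_Aa'$, functorial up to $\approx$, with $B_\alpha\approx B_{\alpha'}$ for all $\alpha,\alpha':a\approx a'$. Write $b\approx_\alpha b'$ for $B_\alpha b\approx b'$. $P_BX$ is the setoid on $\sum_{a:A_0}(B\,a\Rightarrow X)$ with $(a,k)\approx(a',k'):=\sum_{\alpha:a\approx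 a'}k\approx k'\circ B_\alpha$. A $P_B$-algebra is a setoid $C$ with extensional $a_C:P_BC\Rightarrow C$. $\mathrm{W}$ is the W-type on $A_0,B_0$ with constructor $\mathsf{sup}$, and $\mathsf{n}(\mathsf{sup}\,a\,f)\equiv a$, $\mathsf{b}(\mathsf{sup}\,a\,f)\equiv f$. $\mathcal{W}_B$ is the inductive family on $\mathrm{W}\times\mathrm{W}$ with single constructor $\mathsf{dsup}\,(w,w')\,\alpha\,\phi:\mathcal{W}_B\,w\,w'$ for $\alpha:\mathsf{n}w\approx_A\mathsf{n}w'$ and $\phi:\prod_{(b,b',\beta):\sum_{b,b'}b\approx_\alpha b'}\mathcal{W}_B(\mathsf{b}\,w\,b)(\mathsf{b}\,w'\,b')$. The setoid $W$ has underlying type $\sum_w\mathcal{W}_B\,w\,w$ and $(w,\_)\approx_W(w',\_):=\mathcal{W}_B\,w\,w'$. For $\gamma:w\approx_Ww'$, $\mathsf{n}\triangleright\gamma:\mathsf{n}w\approx_A\mathsf{n}w'$ is its label component; each $\mathsf{b}\,w:B(\mathsf{n}w)\Rightarrow W$ is extensional. For $w:W$, $\mathsf{ImS}\,w$ is the setoid on $B_0(\mathsf{n}w)$ with $s\approx s':=\mathsf{b}\,w\,s\approx_W\mathsf{b}\,w\,s'$; for $\gamma:w\approx_Ww'$, $\mathsf{ImS}_\gamma:=B_{\mathsf{n}\triangleright\gamma}:\mathsf{ImS}\,w\Rightarrow\mathsf{ImS}\,w'$. $e_w:B(\mathsf{n}w)\Rightarrow\mathsf{ImS}\,w$ is the identity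 on underlying types. $\mathsf{CohMaps}\,w$ is the setoid of families $F:\prod_{s:\mathsf{ImS}\,w}\mathsf{ImS}(\mathsf{b}\,w\,s)\Rightarrow C$ such that $F\,s\approx(F\,s')\circ\mathsf{ImS}_\sigma$ for all $\sigma:\mathsf{b}\,w\,s\approx_W\mathsf{b}\,w\,s'$. For $F:\mathsf{CohMaps}\,w$, $\mathsf{recst}\,w\,F:\mathsf{ImS}\,w\Rightarrow C$ is $s\mapsto a_C(\mathsf{n}(\mathsf{b}\,w\,s),(F\,s)\circ e_{\mathsf{b}ws})$. For $k:\mathsf{ImS}\,w\Rightarrow C$, $\mathsf{RecDef}\,w\,k$ is the inductive family (dependent W-type indexed by $\sum_{w:W}(\mathsf{ImS}\,w\Rightarrow C)$) with the single constructor: from $F:\mathsf{CohMaps}\,w$, a proof of $k\approx\mathsf{recst}\,w\,F$ and $\prod_{s:B_0(\mathsf{n}w)}\mathsf{RecDef}\,(\mathsf{b}\,w\,s)\,(F\,s)$, form an element of $\mathsf{RecDef}\,w\,k$. -}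

module Defs where

open import Level using (0ℓ)
open import Data.Product using (Σ; Σ-syntax; _,_; proj₁; proj₂)
open import Relation.Binary.Bundles using (Setoid)
open import Function.Bundles using (Func; _⟨$⟩_)
import Function.Construct.Composition as Comp
import Function.Relation.Binary.Setoid.Equality as FEq

SSetoid : Set₁
SSetoid = Setoid 0ℓ 0ℓ

_⇒_ : SSetoid → SSetoid → Set
X ⇒ Y = Func X Y

_∘F_ : {X Y Z : SSetoid} → Y ⇒ Z → X ⇒ Y → X ⇒ Z
g ∘F f = Comp.function f g

_≈F_ : {X Y : SSetoid} → X ⇒ Y → X ⇒ Y → Set
_≈F_ {X} {Y} f g = FEq._≈_ X Y f g

record SetoidFamily (A : SSetoid) : Set₁ where
  open Setoid A renaming (Carrier to A₀; _≈_ to _≈A_)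
  field
    Fam    : A₀ → SSetoid
    tr     : {a a' : A₀} → a ≈A a' → Fam a ⇒ Fam a'
    tr-id  : {a : A₀} (α : a ≈A a) (x : Setoid.Carrier (Fam a)) →
             Setoid._≈_ (Fam a) (tr α ⟨$⟩ x) x
    tr-∘   : {a a' a'' : A₀} (α : a ≈A a') (α' : a' ≈A a'') (α'' : a ≈A a'')
             (x : Setoid.Carrier (Fam a)) →
             Setoid._≈_ (Fam a'') (tr α' ⟨$⟩ (tr α ⟨$⟩ x)) (tr α'' ⟨$⟩ x)
    tr-irr : {a a' : A₀} (α α' : a ≈A a') → tr α ≈F tr α'

module Setup (A : SSetoid) (B : SetoidFamily A) where
  open Setoid A renaming (Carrier to A₀; _≈_ to _≈A_)
  open SetoidFamily B

  B₀ : A₀ → Set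
  B₀ a = Setoid.Carrier (Fam a)

  _≈B_ : {a : A₀} → B₀ a → B₀ a → Set
  _≈B_ {a} = Setoid._≈_ (Fam a)

  _≈[_]_ : {a a' : A₀} → B₀ a → a ≈A a' → B₀ a' → Set
  b ≈[ α ] b' = (tr α ⟨$⟩ b) ≈B b'

  module BR {a : A₀} = Setoid (Fam a)
  module AR = Setoid A

  P : SSetoid → SSetoid
  P X = record
    { Carrier = Σ[ a ∈ A₀ ] (Fam a ⇒ X)
    ; _≈_ = λ { (a , k) (a' , k') → Σ[ α ∈ a ≈A a' ] (k ≈F (k' ∘F tr α)) }
    ; isEquivalence = record
      { refl = λ { {a , k} → AR.refl , λ x → Func.cong k (BR.sym (tr-id AR.refl x)) }
      ; sym = λ { {a , k} {a' , k'} (α , h) → AR.sym α , λ x →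
            XR.trans (Func.cong k' (BR.sym (tr-id AR.refl x)))
             (XR.trans (Func.cong k' (BR.sym (tr-∘ (AR.sym α) α AR.refl x)))
               (XR.sym (h (tr (AR.sym α) ⟨$⟩ x)))) }
      ; trans = λ { {a , k} {a' , k'} {a'' , k''} (α , h) (α' , h') → AR.trans α α' , λ x →
            XR.trans (h x) (XR.trans (h' (tr α ⟨$⟩ x))
              (Func.cong k'' (tr-∘ α α' (AR.trans α α') x))) }
      }
    }
    where module XR = Setoid X

  data W : Set where
    sup : (a : A₀) → (B₀ a → W) → W

  n : W → A₀
  n (sup a f) = a

  br : (w : W) → B₀ (n w) → W
  br (sup a f) = f

  data 𝒲 : W → W → Set where
    dsup : (w w' : W) (α : n w ≈A n w') →
           ((bbβ : Σ[ b ∈ B₀ (n w) ] Σ[ b' ∈ B₀ (n w') ] (b ≈[ α ] b')) →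
              𝒲 (br w (proj₁ bbβ)) (br w' (proj₁ (proj₂ bbβ)))) →
           𝒲 w w'

  𝒲-sym : {w w' : W} → 𝒲 w w' → 𝒲 w' w
  𝒲-sym (dsup w w' α φ) = dsup w' w (AR.sym α) λ { (b' , b , β) →
    𝒲-sym (φ (b , b' ,
      BR.trans (Func.cong (tr α) (BR.sym β))
        (BR.trans (tr-∘ (AR.sym α) α AR.refl b') (tr-id AR.refl b')))) }

  𝒲-trans : {w w' w'' : W} → 𝒲 w w' → 𝒲 w' w'' → 𝒲 w w''
  𝒲-trans (dsup w w' α φ) (dsup .w' w'' α' φ') =
    dsup w w'' (AR.trans α α') λ { (b , b'' , β) →
      𝒲-trans (φ (b , tr α ⟨$⟩ b , BR.refl))
              (φ' (tr α ⟨$⟩ b , b'' , BR.trans (tr-∘ α α' (AR.trans α α') b) β)) }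

  Wˢ : SSetoid
  Wˢ = record
    { Carrier = Σ[ w ∈ W ] 𝒲 w w
    ; _≈_ = λ x y → 𝒲 (proj₁ x) (proj₁ y)
    ; isEquivalence = record
      { refl = λ { {w , p} → p }
      ; sym = 𝒲-sym
      ; trans = 𝒲-trans
      }
    }

  Wc : Set
  Wc = Setoid.Carrier Wˢ

  _≈W_ : Wc → Wc → Set
  _≈W_ = Setoid._≈_ Wˢ

  nW : Wc → A₀
  nW (w , _) = n w

  n▷ : {w w' : Wc} → w ≈W w' → nW w ≈A nW w'
  n▷ (dsup _ _ α _) = α

  bW : (w : Wc) → B₀ (nW w) → Wc
  bW (w , dsup .w .w α φ) s = br w s , φ (s , s , tr-id α s)

  bW-ext : (w : Wc) {s s' : B₀ (nW w)} → s ≈B s' → bW w s ≈W bW w s'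
  bW-ext (w , dsup .w .w α φ) {s} {s'} e = φ (s , s' , BR.trans (tr-id α s) e)

  ImS : Wc → SSetoid
  ImS w = record
    { Carrier = B₀ (nW w)
    ; _≈_ = λ s s' → bW w s ≈W bW w s'
    ; isEquivalence = record
      { refl = λ {s} → Setoid.refl Wˢ {bW w s}
      ; sym = λ {s} {s'} → Setoid.sym Wˢ {bW w s} {bW w s'}
      ; trans = λ {s} {s'} {s''} → Setoid.trans Wˢ {bW w s} {bW w s'} {bW w s''}
      }
    }

  ImS-tr-cong : {w w' : Wc} (γ : w ≈W w') {s s' : B₀ (nW w)} →
                bW w s ≈W bW w s' →
                bW w' (tr (n▷ {w} {w'} γ) ⟨$⟩ s) ≈W bW w' (tr (n▷ {w} {w'} γ) ⟨$⟩ s')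
  ImS-tr-cong {w₀ , dsup .w₀ .w₀ α₀ φ₀} {w₁ , dsup .w₁ .w₁ α₁ φ₁} (dsup .w₀ .w₁ α φ) {s} {s'} σ =
    𝒲-trans (𝒲-sym (φ (s , tr α ⟨$⟩ s , BR.refl)))
      (𝒲-trans σ (φ (s' , tr α ⟨$⟩ s' , BR.refl)))

  ImS-tr : {w w' : Wc} → w ≈W w' → ImS w ⇒ ImS w'
  ImS-tr {w} {w'} γ = record { to = λ s → tr (n▷ {w} {w'} γ) ⟨$⟩ s ; cong = ImS-tr-cong {w} {w'} γ }

  e : (w : Wc) → Fam (nW w) ⇒ ImS w
  e w = record { to = λ s → s ; cong = bW-ext w }

  module Rec (C : SSetoid) (aC : P C ⇒ C) where

    record CohMaps (w : Wc) : Set where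
      field
        F   : (s : B₀ (nW w)) → ImS (bW w s) ⇒ C
        coh : (s s' : B₀ (nW w)) (σ : bW w s ≈W bW w s') →
              F s ≈F (F s' ∘F ImS-tr {bW w s} {bW w s'} σ)
    open CohMaps public

    recst : (w : Wc) → CohMaps w → ImS w ⇒ C
    recst w Fc = record
      { to = λ s → aC ⟨$⟩ (nW (bW w s) , (F Fc s ∘F e (bW w s)))
      ; cong = λ {s} {s'} σ → Func.cong aC (n▷ {bW w s} {bW w s'} σ , coh Fc s s' σ)
      }

    data RecDef : (w : Wc) → ImS w ⇒ C → Set where
      recdef : {w : Wc} {k : ImS w ⇒ C} (Fc : CohMaps w) →
               k ≈F recst w Fc →
               ((s : B₀ (nW w)) → RecDef (bW w s) (F Fc s)) →
               RecDef w k

module Submission where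

-- A witness of RecDef w k is a well-founded tree: at the
-- root a coherent family F : CohMaps w with k ≈ recst w F, and below every
-- branch s a witness for (b w s, F s).  Given δ : w' ≈ w we transport such a
-- tree along δ by recursion on it:
--   * every branch of w' is equal in W to the corresponding branch of w
--     (branch-along), so a coherent family over w pulls back to one over w'
--     by precomposing each component with ImS along that equality
--     (pullback-CohMaps; coherence reduces to a commuting square of
--     transports, tr-square);
--   * the root equation is carried along since recst commutes with the
--     pullback (pullback-recst, using that transports along α and α⁻¹
--     cancel, tr-cancel);
--   * the subtrees are transported recursively (transport-RecDef).
-- The theorem is the instance δ = γ⁻¹.

open import Defs
open import Relation.Binary.Bundles using (Setoid)
open import Data.Product using (_,_)
open import Function.Bundles using (Func; _⟨$⟩_)

module Transports (A : SSetoid) (B : SetoidFamily A) where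
  open Setoid A renaming (Carrier to A₀; _≈_ to _≈A_)
  open SetoidFamily B
  open Setup A B using (B₀; _≈B_)
  private
    module AR = Setoid A
    module BR {a : A₀} = Setoid (Fam a)

  tr-square : {a b b' c : A₀} (α : a ≈A b) (β : b ≈A c) (α' : a ≈A b') (β' : b' ≈A c)
              (z : B₀ a) → (tr β ⟨$⟩ (tr α ⟨$⟩ z)) ≈B (tr β' ⟨$⟩ (tr α' ⟨$⟩ z))
  tr-square α β α' β' z =
    BR.trans (tr-∘ α β αβ z)
      (BR.trans (tr-irr αβ (AR.trans α' β') z) (BR.sym (tr-∘ α' β' _ z)))
    where αβ = AR.trans α β

  tr-cancel : {a a' : A₀} (α : a ≈A a') (z : B₀ a') → (tr α ⟨$⟩ (tr (AR.sym α) ⟨$⟩ z)) ≈B z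
  tr-cancel α z = BR.trans (tr-∘ (AR.sym α) α AR.refl z) (tr-id AR.refl z)

module Transport (A : SSetoid) (B : SetoidFamily A) (C : SSetoid) (aC : Setup.P A B C ⇒ C) where
  open Setup A B
  open SetoidFamily B
  open Rec C aC
  open Transports A B
  module CR = Setoid C
  module WR = Setoid Wˢ

  along : {w w' : Wc} → w' ≈W w → B₀ (nW w') → B₀ (nW w)
  along {w} {w'} δ s' = ImS-tr {w'} {w} δ ⟨$⟩ s'

  branch-along : {w w' : Wc} (δ : w' ≈W w) (s' : B₀ (nW w')) →
                 bW w' s' ≈W bW w (along {w} {w'} δ s')
  branch-along {_ , dsup _ _ _ _} {_ , dsup _ _ _ _} (dsup _ _ α φ) s' =
    φ (s' , tr α ⟨$⟩ s' , BR.refl)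

  -- A map out of ImS u respects equality of labels in B (n u), since such
  -- labels index equal branches of u.
  F-cong : (u : Wc) (G : ImS u ⇒ C) {t t' : B₀ (nW u)} → t ≈B t' → (G ⟨$⟩ t) CR.≈ (G ⟨$⟩ t')
  F-cong u G e = Func.cong G (bW-ext u e)

  pullback-CohMaps : {w w' : Wc} → w' ≈W w → CohMaps w → CohMaps w'
  pullback-CohMaps {w} {w'} δ Fc = record { F = F' ; coh = coh' }
    where
      y : B₀ (nW w') → B₀ (nW w)
      y = along {w} {w'} δ

      δ[_] : (s : B₀ (nW w')) → bW w' s ≈W bW w (y s)
      δ[ s ] = branch-along {w} {w'} δ s

      F' : (s : B₀ (nW w')) → ImS (bW w' s) ⇒ C
      F' s = F Fc (y s) ∘F ImS-tr {bW w' s} {bW w (y s)} δ[ s ]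

      coh' : (s₁ s₂ : B₀ (nW w')) (σ : bW w' s₁ ≈W bW w' s₂) →
             F' s₁ ≈F (F' s₂ ∘F ImS-tr {bW w' s₁} {bW w' s₂} σ)
      coh' s₁ s₂ σ z = CR.trans (coh Fc (y s₁) (y s₂) σ' _) (F-cong (bW w (y s₂)) (F Fc (y s₂)) square)
        where
          σ' : bW w (y s₁) ≈W bW w (y s₂)
          σ' = WR.trans {bW w (y s₁)} {bW w' s₁} {bW w (y s₂)}
                 (WR.sym {bW w' s₁} {bW w (y s₁)} δ[ s₁ ])
                 (WR.trans {bW w' s₁} {bW w' s₂} {bW w (y s₂)} σ δ[ s₂ ])
          square = tr-square (n▷ {bW w' s₁} {bW w (y s₁)} δ[ s₁ ])
                             (n▷ {bW w (y s₁)} {bW w (y s₂)} σ')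
                             (n▷ {bW w' s₁} {bW w' s₂} σ)
                             (n▷ {bW w' s₂} {bW w (y s₂)} δ[ s₂ ]) z

  pullback-recst : {w w' : Wc} (δ : w' ≈W w) (Fc : CohMaps w) →
                   (recst w Fc ∘F ImS-tr {w'} {w} δ) ≈F recst w' (pullback-CohMaps {w} {w'} δ Fc)
  pullback-recst {w} {w'} δ Fc s = Func.cong aC (AR.sym nδ , λ z →
      F-cong (bW w (along {w} {w'} δ s)) (F Fc (along {w} {w'} δ s)) (BR.sym (tr-cancel nδ z)))
    where nδ = n▷ {bW w' s} {bW w (along {w} {w'} δ s)} (branch-along {w} {w'} δ s)

  transport-RecDef : (w w' : Wc) (δ : w' ≈W w) (k : ImS w ⇒ C) → RecDef w k →
                     RecDef w' (k ∘F ImS-tr {w'} {w} δ)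
  transport-RecDef w w' δ k (recdef Fc k≈ subtrees) =
    recdef (pullback-CohMaps {w} {w'} δ Fc)
      (λ s → CR.trans (k≈ (along {w} {w'} δ s)) (pullback-recst {w} {w'} δ Fc s))
      (λ s → transport-RecDef (bW w (along {w} {w'} δ s)) (bW w' s)
               (branch-along {w} {w'} δ s) (F Fc (along {w} {w'} δ s))
               (subtrees (along {w} {w'} δ s)))

lemma3p10 : (A : SSetoid) (B : SetoidFamily A) (C : SSetoid) (aC : Setup.P A B C ⇒ C)
    (w w' : Setup.Wc A B) (γ : Setup._≈W_ A B w w') (k : Setup.ImS A B w ⇒ C) →
    Setup.Rec.RecDef A B C aC w k →
    Setup.Rec.RecDef A B C aC w'
    (k ∘F Setup.ImS-tr A B {w'} {w} (Setoid.sym (Setup.Wˢ A B) {w} {w'} γ))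
lemma3p10 A B C aC w w' γ k =
  Transport.transport-RecDef A B C aC w w' (Setoid.sym (Setup.Wˢ A B) {w} {w'} γ) k
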